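{- Let $n\ge 2$. Then \[ \sum_{(a,b,c,d)\in B,\ c\ge d} q^{(n-a)+(n+1-b)+(c-1)+(d-1)}+\sum_{(a,b,c,d)\in A,\ a<b} q^{(n-a)+(n+1-b)+(c-1)+(d-1)} =\sum_{\substack{(a,b,c,d)\in\mathbb{Z}^4\\ 1\le a<b\le n+1\\ 1\le d\le c\le n}} q^{(n-a)+(n+1-b)+(c-1)+(d-1)} ={\genfrac{[}{]}{0pt}{0}{n+1}{2}}_q^{2}, \] where the first two sums run over the location labels of the unit cubes of block $B$ with $c\ge d$ and of block $A$ with $a<b$ respectively.
   Context: $[k]_q=1+q+\cdots+q^{k-1}$, $[k]_q!=\prod_{i=1}^k[i]_q$, $[0]_q!=1$, and ${\genfrac{[}{]}{0pt}{1}{m}{k}}_q=[m]_q!/([k]_q!\,[m-k]_q!)$. For fixed $n\ge 2$, block $A$ is the set of location labels $\{(x,y,z,w)\in\mathbb{Z}^4: 1\le i\le n,\ z=i,\ x,y,w\in\{1,\dots,i\}\}$ and block $B$ is the set of location labels $\{(x,y,z,w)\in\mathbb{Z}^4: 1\le i\le n,\ y=i+1,\ x,z,w\in\{1,\dots,i\}\}$. -}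

module Defs where

open import Data.Nat using (ℕ; zero; suc; _+_; _*_; _∸_; _^_; _≤_; _<_; _≤?_; _<?_; NonZero)
open import Data.Nat.Properties using (m*n≢0)
open import Data.Nat.DivMod using (_/_)
open import Data.List using (List; []; _∷_; map; upTo; concatMap; filter)
open import Data.Nat.ListAction using (sum)
open import Data.Product using (_×_; _,_)

qint : ℕ → ℕ → ℕ
qint k q = sum (map (q ^_) (upTo k))

qfact : ℕ → ℕ → ℕ
qfact zero    q = 1
qfact (suc k) q = qint (suc k) q * qfact k q

qint-nonzero : ∀ k q → NonZero (qint (suc k) q)
qint-nonzero k q = _

qfact-nonzero : ∀ k q → NonZero (qfact k q)
qfact-nonzero zero    q = _
qfact-nonzero (suc k) q =
  m*n≢0 (qint (suc k) q) (qfact k q) {{qint-nonzero k q}} {{qfact-nonzero k q}}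

qbinom : ℕ → ℕ → ℕ → ℕ
qbinom m k q = _/_ (qfact m q) (qfact k q * qfact (m ∸ k) q)
  {{m*n≢0 (qfact k q) (qfact (m ∸ k) q) {{qfact-nonzero k q}} {{qfact-nonzero (m ∸ k) q}}}}

Label : Set
Label = ℕ × ℕ × ℕ × ℕ

range : ℕ → List ℕ
range k = map suc (upTo k)

blockA : ℕ → List Label
blockA n = concatMap (λ i →
             concatMap (λ x →
               concatMap (λ y →
                 map (λ w → (x , y , i , w)) (range i)) (range i)) (range i)) (range n)

blockB : ℕ → List Label
blockB n = concatMap (λ i →
             concatMap (λ x →
               concatMap (λ z →
                 map (λ w → (x , suc i , z , w)) (range i)) (range i)) (range i)) (range n)

box : ℕ → List Label
box n = filter (λ { (a , b , c , d) → a <? b })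
          (filter (λ { (a , b , c , d) → d ≤? c })
            (concatMap (λ a →
              concatMap (λ b →
                concatMap (λ c →
                  map (λ d → (a , b , c , d)) (range n)) (range n)) (range (suc n))) (range (suc n))))

-- weight q^{(n-a)+(n+1-b)+(c-1)+(d-1)}  (all subtractions are non-truncating on the index sets used)
wt : ℕ → ℕ → Label → ℕ
wt n q (a , b , c , d) = q ^ ((n ∸ a) + (suc n ∸ b) + (c ∸ 1) + (d ∸ 1))

wsum : ℕ → ℕ → List Label → ℕ
wsum n q ls = sum (map (wt n q) ls)

blockB-ge : ℕ → List Label
blockB-ge n = filter (λ { (a , b , c , d) → d ≤? c }) (blockB n)

blockA-lt : ℕ → List Label
blockA-lt n = filter (λ { (a , b , c , d) → a <? b }) (blockA n)

-- The first identity holds for every weight g on labels.  Write Box m for the labels with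
-- 1 ≤ a < b ≤ m + 1 and 1 ≤ d ≤ c ≤ m.  Box (m + 1) ∖ Box m consists of the labels with
-- b = m + 2, which form layer m + 1 of block B, and those with b ≤ m + 1 and c = m + 1, which
-- form layer m + 1 of block A; so the sum over Box n telescopes into the sum over all layers.
--
-- For the second, the weight splits into a factor depending on (a, b) and one depending on
-- (c, d), so the box sum is a product of two triangular sums.  Peeling off the row a = 1,
-- resp. the column c = n + 1, shows that both satisfy S (n + 1) = S n + q^n [n + 1]_q, hence
-- both equal T n = ∑_{i ≤ n} q^(i - 1) [i]_q, and (1 + q) T n = [n + 1]_q [n]_q.

module Submission where

open import Defs
open import Data.Nat using (ℕ; zero; suc; _+_; _*_; _^_; _∸_; _≤_; _<?_; _≤?_; z≤n; s≤s)
open import Data.Product using (_×_; _,_)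
open import Relation.Binary.PropositionalEquality
  using (_≡_; _≗_; refl; sym; trans; cong; cong₂; module ≡-Reasoning)

open import Algebra.Properties.CommutativeSemigroup using (interchange)
open import Data.Bool using (true; false; if_then_else_)
open import Data.List using (List; []; _∷_; _++_; map; upTo; concatMap; filter)
open import Data.List.Properties using (map-∘; map-cong; map-++; map-applyUpTo)
open import Data.Nat.DivMod using (_/_; m*n/n≡m)
open import Data.Nat.ListAction using (sum)
open import Data.Nat.ListAction.Properties using (sum-++)
open import Data.Nat.Properties
  using (+-identityʳ; +-comm; +-assoc; *-identityʳ; *-zeroʳ; *-comm; *-assoc;
         *-distribˡ-+; *-distribʳ-+; ^-distribˡ-+-*; <⇒≱; ≤⇒≯; m*n≢0;
         +-commutativeSemigroup)
open import Data.Nat.Tactic.RingSolver using (solve-∀)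
open import Function using (id; _∘_)
open import Relation.Nullary using (Dec; yes; no; does; ¬_)
open import Relation.Nullary.Negation using (contradiction)

open ≡-Reasoning

∑ : ∀ {A : Set} → List A → (A → ℕ) → ℕ
∑ xs f = sum (map f xs)

infix 6.5 ∑
syntax ∑ xs (λ x → e) = ∑[ x ∈ xs ] e

when : ∀ {P : Set} → Dec P → ℕ → ℕ
when P? x = if does P? then x else 0

when-yes : ∀ {P : Set} (P? : Dec P) {x} → P → when P? x ≡ x
when-yes (yes _) p = refl
when-yes (no ¬p) p = contradiction p ¬p

when-no : ∀ {P : Set} (P? : Dec P) {x} → ¬ P → when P? x ≡ 0
when-no (yes p) ¬p = contradiction p ¬p
when-no (no _)  ¬p = refl

when-comm : ∀ {P Q : Set} (P? : Dec P) (Q? : Dec Q) x → when P? (when Q? x) ≡ when Q? (when P? x)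
when-comm P? Q? x with does P? | does Q?
... | true  | true  = refl
... | true  | false = refl
... | false | true  = refl
... | false | false = refl

when-+ : ∀ {P : Set} (P? : Dec P) x y → when P? (x + y) ≡ when P? x + when P? y
when-+ P? x y with does P?
... | true  = refl
... | false = refl

when-*ˡ : ∀ {P : Set} (P? : Dec P) c x → when P? (c * x) ≡ c * when P? x
when-*ˡ P? c x with does P?
... | true  = refl
... | false = sym (*-zeroʳ c)

when-*ʳ : ∀ {P : Set} (P? : Dec P) x c → when P? (x * c) ≡ when P? x * c
when-*ʳ P? x c with does P?
... | true  = refl
... | false = refl

module _ {A : Set} where

  ∑-cong : ∀ {f g : A → ℕ} → f ≗ g → ∀ xs → ∑ xs f ≡ ∑ xs g
  ∑-cong f≗g xs = cong sum (map-cong f≗g xs)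

  ∑-zero : ∀ (xs : List A) → ∑[ x ∈ xs ] 0 ≡ 0
  ∑-zero []       = refl
  ∑-zero (_ ∷ xs) = ∑-zero xs

  ∑-+ : ∀ (f g : A → ℕ) xs → ∑[ x ∈ xs ] (f x + g x) ≡ ∑ xs f + ∑ xs g
  ∑-+ f g []       = refl
  ∑-+ f g (x ∷ xs) = trans (cong (f x + g x +_) (∑-+ f g xs))
                           (interchange +-commutativeSemigroup (f x) (g x) _ _)

  ∑-*ˡ : ∀ c (f : A → ℕ) xs → ∑[ x ∈ xs ] (c * f x) ≡ c * ∑ xs f
  ∑-*ˡ c f []       = sym (*-zeroʳ c)
  ∑-*ˡ c f (x ∷ xs) = trans (cong (c * f x +_) (∑-*ˡ c f xs)) (sym (*-distribˡ-+ c (f x) _))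

  ∑-*ʳ : ∀ c (f : A → ℕ) xs → ∑[ x ∈ xs ] (f x * c) ≡ ∑ xs f * c
  ∑-*ʳ c f xs = trans (∑-cong (λ x → *-comm (f x) c) xs) (trans (∑-*ˡ c f xs) (*-comm c _))

  ∑-when : ∀ {P : Set} (P? : Dec P) (f : A → ℕ) xs → ∑[ x ∈ xs ] when P? (f x) ≡ when P? (∑ xs f)
  ∑-when (yes _) f xs = refl
  ∑-when (no _)  f xs = ∑-zero xs

  ∑-filter : ∀ {P : A → Set} (P? : ∀ x → Dec (P x)) (f : A → ℕ) xs →
    ∑ (filter P? xs) f ≡ ∑[ x ∈ xs ] when (P? x) (f x)
  ∑-filter P? f []       = refl
  ∑-filter P? f (x ∷ xs) with does (P? x)
  ... | true  = cong (f x +_) (∑-filter P? f xs)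
  ... | false = ∑-filter P? f xs

  ∑-concatMap : ∀ {B : Set} (f : B → ℕ) (g : A → List B) xs →
    ∑ (concatMap g xs) f ≡ ∑[ x ∈ xs ] ∑ (g x) f
  ∑-concatMap f g []       = refl
  ∑-concatMap f g (x ∷ xs) = begin
    sum (map f (g x ++ concatMap g xs))       ≡⟨ cong sum (map-++ f (g x) (concatMap g xs)) ⟩
    sum (map f (g x) ++ map f (concatMap g xs)) ≡⟨ sum-++ (map f (g x)) _ ⟩
    ∑ (g x) f + ∑ (concatMap g xs) f          ≡⟨ cong (∑ (g x) f +_) (∑-concatMap f g xs) ⟩
    ∑ (g x) f + ∑[ x ∈ xs ] ∑ (g x) f         ∎

∑-concatMap³ : ∀ {A : Set} (f : A → ℕ) (F : ℕ → ℕ → ℕ → ℕ → A)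
  (ys : ℕ → List ℕ) (zs : ℕ → ℕ → List ℕ) (ws : ℕ → ℕ → ℕ → List ℕ) xs →
  ∑ (concatMap (λ x → concatMap (λ y → concatMap (λ z →
       map (F x y z) (ws x y z)) (zs x y)) (ys x)) xs) f
  ≡ ∑[ x ∈ xs ] ∑[ y ∈ ys x ] ∑[ z ∈ zs x y ] ∑[ w ∈ ws x y z ] f (F x y z w)
∑-concatMap³ f F ys zs ws xs =
  trans (∑-concatMap f _ xs) (∑-cong (λ x →
  trans (∑-concatMap f _ (ys x)) (∑-cong (λ y →
  trans (∑-concatMap f _ (zs x y)) (∑-cong (λ z →
  cong sum (sym (map-∘ (ws x y z)))) (zs x y))) (ys x))) xs)

∑-range-cons : ∀ k f → ∑ (range (suc k)) f ≡ f 1 + ∑[ x ∈ range k ] f (suc x)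
∑-range-cons k f = trans
  (cong (λ xs → f 1 + ∑ (map suc xs) f) (sym (map-applyUpTo id suc k)))
  (cong (λ xs → f 1 + sum xs) (sym (map-∘ (range k))))

∑-range-suc : ∀ k f → ∑ (range (suc k)) f ≡ ∑ (range k) f + f (suc k)
∑-range-suc zero    f = +-identityʳ (f 1)
∑-range-suc (suc k) f = begin
  ∑ (range (suc (suc k))) f                        ≡⟨ ∑-range-cons (suc k) f ⟩
  f 1 + ∑ (range (suc k)) (f ∘ suc)                ≡⟨ cong (f 1 +_) (∑-range-suc k (f ∘ suc)) ⟩
  f 1 + (∑ (range k) (f ∘ suc) + f (suc (suc k)))  ≡⟨ +-assoc (f 1) _ _ ⟨
  f 1 + ∑ (range k) (f ∘ suc) + f (suc (suc k))    ≡⟨ cong (_+ f (suc (suc k))) (∑-range-cons k f) ⟨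
  ∑ (range (suc k)) f + f (suc (suc k))            ∎

∑-range-cong : ∀ k {f g : ℕ → ℕ} → (∀ x → 1 ≤ x → x ≤ k → f x ≡ g x) →
  ∑ (range k) f ≡ ∑ (range k) g
∑-range-cong zero    eq = refl
∑-range-cong (suc k) {f} {g} eq = begin
  ∑ (range (suc k)) f                  ≡⟨ ∑-range-cons k f ⟩
  f 1 + ∑[ x ∈ range k ] f (suc x)
    ≡⟨ cong₂ _+_ (eq 1 (s≤s z≤n) (s≤s z≤n))
                 (∑-range-cong k (λ x _ x≤k → eq (suc x) (s≤s z≤n) (s≤s x≤k))) ⟩
  g 1 + ∑[ x ∈ range k ] g (suc x)     ≡⟨ ∑-range-cons k g ⟨
  ∑ (range (suc k)) g                  ∎

∑-range-vanish : ∀ k {f : ℕ → ℕ} → (∀ x → 1 ≤ x → x ≤ k → f x ≡ 0) → ∑ (range k) f ≡ 0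
∑-range-vanish k eq = trans (∑-range-cong k eq) (∑-zero (range k))

∑-telescope : ∀ {F f : ℕ → ℕ} → F 0 ≡ 0 → (∀ m → F (suc m) ≡ F m + f (suc m)) →
  ∀ m → ∑ (range m) f ≡ F m
∑-telescope F0 Fsuc zero              = sym F0
∑-telescope {F} {f} F0 Fsuc (suc m) = begin
  ∑ (range (suc m)) f        ≡⟨ ∑-range-suc m f ⟩
  ∑ (range m) f + f (suc m)  ≡⟨ cong (_+ f (suc m)) (∑-telescope F0 Fsuc m) ⟩
  F m + f (suc m)            ≡⟨ Fsuc m ⟨
  F (suc m)                  ∎

∑-reflect : ∀ k (f : ℕ → ℕ) → ∑[ x ∈ range k ] f (k ∸ x) ≡ ∑[ x ∈ range k ] f (x ∸ 1)
∑-reflect zero    f = refl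
∑-reflect (suc k) f = begin
  ∑[ x ∈ range (suc k) ] f (suc k ∸ x)   ≡⟨ ∑-range-cons k _ ⟩
  f k + ∑[ x ∈ range k ] f (k ∸ x)       ≡⟨ cong (f k +_) (∑-reflect k f) ⟩
  f k + ∑[ x ∈ range k ] f (x ∸ 1)       ≡⟨ +-comm (f k) _ ⟩
  ∑[ x ∈ range k ] f (x ∸ 1) + f k       ≡⟨ ∑-range-suc k _ ⟨
  ∑[ x ∈ range (suc k) ] f (x ∸ 1)       ∎

∑< : ℕ → (ℕ → ℕ → ℕ) → ℕ
∑< k H = ∑[ a ∈ range k ] ∑[ b ∈ range k ] when (a <? b) (H a b)

infix 6.5 ∑<
syntax ∑< k (λ a b → e) = ∑[ a < b ≤ k ] e

∑≤ : ℕ → (ℕ → ℕ → ℕ) → ℕ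
∑≤ k h = ∑[ c ∈ range k ] ∑[ d ∈ range k ] when (d ≤? c) (h c d)

infix 6.5 ∑≤
syntax ∑≤ k (λ c d → e) = ∑[ d ≤ c ≤ k ] e

∑<-cong : ∀ k {H H′ : ℕ → ℕ → ℕ} → (∀ a b → H a b ≡ H′ a b) → ∑< k H ≡ ∑< k H′
∑<-cong k eq = ∑-cong (λ a → ∑-cong (λ b → cong (when (a <? b)) (eq a b)) (range k)) (range k)

∑≤-cong : ∀ k {h h′ : ℕ → ℕ → ℕ} → (∀ c d → h c d ≡ h′ c d) → ∑≤ k h ≡ ∑≤ k h′
∑≤-cong k eq = ∑-cong (λ c → ∑-cong (λ d → cong (when (d ≤? c)) (eq c d)) (range k)) (range k)

∑<-+ : ∀ k H H′ → ∑[ a < b ≤ k ] (H a b + H′ a b) ≡ ∑< k H + ∑< k H′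
∑<-+ k H H′ = trans
  (∑-cong (λ a → trans (∑-cong (λ b → when-+ (a <? b) (H a b) (H′ a b)) (range k))
                       (∑-+ _ _ (range k))) (range k))
  (∑-+ _ _ (range k))

∑<-*ʳ : ∀ k H c → ∑[ a < b ≤ k ] (H a b * c) ≡ ∑< k H * c
∑<-*ʳ k H c = trans
  (∑-cong (λ a → trans (∑-cong (λ b → when-*ʳ (a <? b) (H a b) c) (range k))
                       (∑-*ʳ c _ (range k))) (range k))
  (∑-*ʳ c _ (range k))

∑≤-*ˡ : ∀ k x h → ∑[ d ≤ c ≤ k ] (x * h c d) ≡ x * ∑≤ k h
∑≤-*ˡ k x h = trans
  (∑-cong (λ c → trans (∑-cong (λ d → when-*ˡ (d ≤? c) x (h c d)) (range k))
                       (∑-*ˡ x _ (range k))) (range k))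
  (∑-*ˡ x _ (range k))

∑<-suc : ∀ k H → ∑< (suc k) H ≡ ∑< k H + ∑[ a ∈ range k ] H a (suc k)
∑<-suc k H = begin
  ∑< (suc k) H
    ≡⟨ ∑-range-suc k row ⟩
  ∑ (range k) row + row (suc k)
    ≡⟨ cong₂ _+_ (∑-range-cong k (λ a _ a≤k → row-suc a≤k))
                 (∑-range-vanish (suc k) (λ b _ b≤k+1 → when-no (suc k <? b) (≤⇒≯ b≤k+1))) ⟩
  ∑[ a ∈ range k ] (∑[ b ∈ range k ] when (a <? b) (H a b) + H a (suc k)) + 0
    ≡⟨ +-identityʳ _ ⟩
  ∑[ a ∈ range k ] (∑[ b ∈ range k ] when (a <? b) (H a b) + H a (suc k))
    ≡⟨ ∑-+ _ _ (range k) ⟩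
  ∑< k H + ∑[ a ∈ range k ] H a (suc k) ∎
  where
  row : ℕ → ℕ
  row a = ∑[ b ∈ range (suc k) ] when (a <? b) (H a b)
  row-suc : ∀ {a} → a ≤ k → row a ≡ ∑[ b ∈ range k ] when (a <? b) (H a b) + H a (suc k)
  row-suc {a} a≤k = trans (∑-range-suc k (λ b → when (a <? b) (H a b)))
                          (cong (∑[ b ∈ range k ] when (a <? b) (H a b) +_)
                                (when-yes (a <? suc k) (s≤s a≤k)))

∑<-cons : ∀ k H → ∑< (suc k) H ≡ ∑[ b ∈ range k ] H 1 (suc b) + ∑[ a < b ≤ k ] H (suc a) (suc b)
∑<-cons k H = begin
  ∑< (suc k) H
    ≡⟨ ∑-range-cons k row ⟩
  row 1 + ∑[ a ∈ range k ] row (suc a)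
    ≡⟨ cong₂ _+_ (trans (∑-range-cons k (λ b → when (1 <? b) (H 1 b)))
                        (∑-range-cong k (λ { (suc b) _ _ → refl })))
                 (∑-cong (λ a → ∑-range-cons k (λ b → when (suc a <? b) (H (suc a) b))) (range k)) ⟩
  ∑[ b ∈ range k ] H 1 (suc b) + ∑[ a < b ≤ k ] H (suc a) (suc b) ∎
  where
  row : ℕ → ℕ
  row a = ∑[ b ∈ range (suc k) ] when (a <? b) (H a b)

∑≤-suc : ∀ k h → ∑≤ (suc k) h ≡ ∑≤ k h + ∑[ d ∈ range (suc k) ] h (suc k) d
∑≤-suc k h = begin
  ∑≤ (suc k) h
    ≡⟨ ∑-range-suc k column ⟩
  ∑ (range k) column + column (suc k)
    ≡⟨ cong₂ _+_ (∑-range-cong k (λ c _ c≤k → column-suc c≤k))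
                 (∑-range-cong (suc k) (λ d _ d≤k+1 → when-yes (d ≤? suc k) d≤k+1)) ⟩
  ∑≤ k h + ∑[ d ∈ range (suc k) ] h (suc k) d ∎
  where
  column : ℕ → ℕ
  column c = ∑[ d ∈ range (suc k) ] when (d ≤? c) (h c d)
  column-suc : ∀ {c} → c ≤ k → column c ≡ ∑[ d ∈ range k ] when (d ≤? c) (h c d)
  column-suc {c} c≤k = begin
    column c
      ≡⟨ ∑-range-suc k (λ d → when (d ≤? c) (h c d)) ⟩
    ∑[ d ∈ range k ] when (d ≤? c) (h c d) + when (suc k ≤? c) (h c (suc k))
      ≡⟨ cong (∑[ d ∈ range k ] when (d ≤? c) (h c d) +_) (when-no (suc k ≤? c) (<⇒≱ (s≤s c≤k))) ⟩
    ∑[ d ∈ range k ] when (d ≤? c) (h c d) + 0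
      ≡⟨ +-identityʳ _ ⟩
    ∑[ d ∈ range k ] when (d ≤? c) (h c d) ∎

boxSum : (Label → ℕ) → ℕ → ℕ
boxSum g m = ∑[ a < b ≤ suc m ] ∑[ d ≤ c ≤ m ] g (a , b , c , d)

layerA : (Label → ℕ) → ℕ → ℕ
layerA g i = ∑[ x < y ≤ i ] ∑[ w ∈ range i ] g (x , y , i , w)

layerB : (Label → ℕ) → ℕ → ℕ
layerB g i = ∑[ x ∈ range i ] ∑[ w ≤ z ≤ i ] g (x , suc i , z , w)

boxSum-suc : ∀ g m → boxSum g (suc m) ≡ boxSum g m + (layerA g (suc m) + layerB g (suc m))
boxSum-suc g m = begin
  boxSum g (suc m)
    ≡⟨ ∑<-suc (suc m) _ ⟩
  ∑[ a < b ≤ suc m ] ∑[ d ≤ c ≤ suc m ] g (a , b , c , d) + layerB g (suc m)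
    ≡⟨ cong (_+ layerB g (suc m)) (∑<-cong (suc m) (λ a b → ∑≤-suc m _)) ⟩
  ∑[ a < b ≤ suc m ] (∑[ d ≤ c ≤ m ] g (a , b , c , d)
                       + ∑[ d ∈ range (suc m) ] g (a , b , suc m , d))
    + layerB g (suc m)
    ≡⟨ cong (_+ layerB g (suc m)) (∑<-+ (suc m) _ _) ⟩
  boxSum g m + layerA g (suc m) + layerB g (suc m)
    ≡⟨ +-assoc (boxSum g m) _ _ ⟩
  boxSum g m + (layerA g (suc m) + layerB g (suc m)) ∎

∑-blockB-ge : ∀ g n → ∑ (blockB-ge n) g ≡ ∑[ i ∈ range n ] layerB g i
∑-blockB-ge g n = trans (∑-filter _ g (blockB n))
  (∑-concatMap³ _ (λ i x z w → (x , suc i , z , w))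
                 range (λ i _ → range i) (λ i _ _ → range i) (range n))

∑-blockA-lt : ∀ g n → ∑ (blockA-lt n) g ≡ ∑[ i ∈ range n ] layerA g i
∑-blockA-lt g n = begin
  ∑ (blockA-lt n) g
    ≡⟨ trans (∑-filter _ g (blockA n))
             (∑-concatMap³ _ (λ i x y w → (x , y , i , w))
                           range (λ i _ → range i) (λ i _ _ → range i) (range n)) ⟩
  ∑[ i ∈ range n ] ∑[ x ∈ range i ] ∑[ y ∈ range i ] ∑[ w ∈ range i ]
    when (x <? y) (g (x , y , i , w))
    ≡⟨ ∑-cong (λ i → ∑-cong (λ x → ∑-cong (λ y →
         ∑-when (x <? y) (λ w → g (x , y , i , w)) (range i)) (range i)) (range i)) (range n) ⟩
  ∑[ i ∈ range n ] layerA g i ∎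

∑-box : ∀ g n → ∑ (box n) g ≡ boxSum g n
∑-box g n = begin
  ∑ (box n) g
    ≡⟨ trans (∑-filter _ g (filter _ labels)) (trans (∑-filter _ _ labels)
         (∑-concatMap³ _ (λ a b c d → (a , b , c , d)) (λ _ → range (suc n))
                       (λ _ _ → range n) (λ _ _ _ → range n) (range (suc n)))) ⟩
  ∑[ a ∈ range (suc n) ] ∑[ b ∈ range (suc n) ] ∑[ c ∈ range n ] ∑[ d ∈ range n ]
    when (d ≤? c) (when (a <? b) (g (a , b , c , d)))
    ≡⟨ ∑-cong (λ a → ∑-cong (λ b → pull-out a b) (range (suc n))) (range (suc n)) ⟩
  boxSum g n ∎
  where
  -- the list that box n filters, named so that Agda can solve the two filter predicates
  labels : List Label
  labels = concatMap (λ a → concatMap (λ b → concatMap (λ c →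
             map (λ d → (a , b , c , d)) (range n)) (range n)) (range (suc n))) (range (suc n))
  pull-out : ∀ a b →
    ∑[ c ∈ range n ] ∑[ d ∈ range n ] when (d ≤? c) (when (a <? b) (g (a , b , c , d)))
    ≡ when (a <? b) (∑[ d ≤ c ≤ n ] g (a , b , c , d))
  pull-out a b = trans
    (∑-cong (λ c → trans (∑-cong (λ d → when-comm (d ≤? c) (a <? b) _) (range n))
                         (∑-when (a <? b) _ (range n))) (range n))
    (∑-when (a <? b) _ (range n))

blocks-partition-box : ∀ g n → ∑ (blockB-ge n) g + ∑ (blockA-lt n) g ≡ ∑ (box n) g
blocks-partition-box g n = begin
  ∑ (blockB-ge n) g + ∑ (blockA-lt n) g
    ≡⟨ cong₂ _+_ (∑-blockB-ge g n) (∑-blockA-lt g n) ⟩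
  ∑ (range n) (layerB g) + ∑ (range n) (layerA g)
    ≡⟨ +-comm (∑ (range n) (layerB g)) _ ⟩
  ∑ (range n) (layerA g) + ∑ (range n) (layerB g)
    ≡⟨ ∑-+ (layerA g) (layerB g) (range n) ⟨
  ∑[ i ∈ range n ] (layerA g i + layerB g i)
    ≡⟨ ∑-telescope {F = boxSum g} refl (boxSum-suc g) n ⟩
  boxSum g n
    ≡⟨ ∑-box g n ⟨
  ∑ (box n) g ∎

qint-range : ∀ k q → ∑[ x ∈ range k ] q ^ (x ∸ 1) ≡ qint k q
qint-range k q = cong sum (sym (map-∘ (upTo k)))

qint-suc : ∀ k q → qint (suc k) q ≡ qint k q + q ^ k
qint-suc k q = begin
  qint (suc k) q                           ≡⟨ qint-range (suc k) q ⟨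
  ∑[ x ∈ range (suc k) ] q ^ (x ∸ 1)       ≡⟨ ∑-range-suc k _ ⟩
  ∑[ x ∈ range k ] q ^ (x ∸ 1) + q ^ k     ≡⟨ cong (_+ q ^ k) (qint-range k q) ⟩
  qint k q + q ^ k                         ∎

qfact-2 : ∀ q → qfact 2 q ≡ 1 + q
qfact-2 q = cong suc (trans (*-identityʳ _) (trans (+-identityʳ _) (*-identityʳ q)))

qbinom-from-qfact : ∀ m k q x → qfact m q ≡ x * (qfact k q * qfact (m ∸ k) q) → qbinom m k q ≡ x
qbinom-from-qfact m k q x eq = trans (cong (λ t → _/_ t D {{D≢0}}) eq) (m*n/n≡m x D {{D≢0}})
  where
  D = qfact k q * qfact (m ∸ k) q
  D≢0 = m*n≢0 (qfact k q) (qfact (m ∸ k) q) {{qfact-nonzero k q}} {{qfact-nonzero (m ∸ k) q}}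

qtriangular : ℕ → ℕ → ℕ
qtriangular n q = ∑[ i ∈ range n ] q ^ (i ∸ 1) * qint i q

qtriangular-closed : ∀ n q → qtriangular n q * (1 + q) ≡ qint (suc n) q * qint n q
qtriangular-closed zero    q = refl
qtriangular-closed (suc n) q = begin
  qtriangular (suc n) q * (1 + q)
    ≡⟨ cong (_* (1 + q)) (∑-range-suc n _) ⟩
  (qtriangular n q + t * qint (suc n) q) * (1 + q)
    ≡⟨ *-distribʳ-+ (1 + q) (qtriangular n q) _ ⟩
  qtriangular n q * (1 + q) + t * qint (suc n) q * (1 + q)
    ≡⟨ cong (_+ t * qint (suc n) q * (1 + q)) (qtriangular-closed n q) ⟩
  qint (suc n) q * I + t * qint (suc n) q * (1 + q)
    ≡⟨ cong (λ J → J * I + t * J * (1 + q)) (qint-suc n q) ⟩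
  (I + t) * I + t * (I + t) * (1 + q)
    ≡⟨ semiring-identity I t q ⟩
  (I + t + q * t) * (I + t)
    ≡⟨ cong₂ _*_ (trans (qint-suc (suc n) q) (cong (_+ q * t) (qint-suc n q))) (qint-suc n q) ⟨
  qint (suc (suc n)) q * qint (suc n) q ∎
  where
  I = qint n q
  t = q ^ n
  semiring-identity : ∀ I t q → (I + t) * I + t * (I + t) * (1 + q) ≡ (I + t + q * t) * (I + t)
  semiring-identity = solve-∀

qbinom-2≡qtriangular : ∀ n q → qbinom (suc (suc n)) 2 q ≡ qtriangular (suc n) q
qbinom-2≡qtriangular n q = qbinom-from-qfact (suc (suc n)) 2 q (qtriangular (suc n) q) (begin
  qint (2 + n) q * (qint (1 + n) q * qfact n q)
    ≡⟨ *-assoc (qint (2 + n) q) (qint (1 + n) q) (qfact n q) ⟨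
  qint (2 + n) q * qint (1 + n) q * qfact n q
    ≡⟨ cong (_* qfact n q) (qtriangular-closed (suc n) q) ⟨
  qtriangular (suc n) q * (1 + q) * qfact n q
    ≡⟨ *-assoc (qtriangular (suc n) q) (1 + q) (qfact n q) ⟩
  qtriangular (suc n) q * ((1 + q) * qfact n q)
    ≡⟨ cong (λ f → qtriangular (suc n) q * (f * qfact n q)) (qfact-2 q) ⟨
  qtriangular (suc n) q * (qfact 2 q * qfact n q) ∎)

abPart : ℕ → ℕ → ℕ
abPart n q = ∑[ a < b ≤ suc n ] q ^ (n ∸ a) * q ^ (suc n ∸ b)

cdPart : ℕ → ℕ → ℕ
cdPart n q = ∑[ d ≤ c ≤ n ] q ^ (c ∸ 1) * q ^ (d ∸ 1)

wt-split : ∀ n q a b c d →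
  wt n q (a , b , c , d) ≡ (q ^ (n ∸ a) * q ^ (suc n ∸ b)) * (q ^ (c ∸ 1) * q ^ (d ∸ 1))
wt-split n q a b c d = begin
  q ^ (eA + eB + eC + eD)                  ≡⟨ ^-distribˡ-+-* q (eA + eB + eC) eD ⟩
  q ^ (eA + eB + eC) * q ^ eD              ≡⟨ cong (_* q ^ eD) (^-distribˡ-+-* q (eA + eB) eC) ⟩
  q ^ (eA + eB) * q ^ eC * q ^ eD          ≡⟨ cong (λ x → x * q ^ eC * q ^ eD)
                                                   (^-distribˡ-+-* q eA eB) ⟩
  q ^ eA * q ^ eB * q ^ eC * q ^ eD        ≡⟨ *-assoc (q ^ eA * q ^ eB) (q ^ eC) (q ^ eD) ⟩
  q ^ eA * q ^ eB * (q ^ eC * q ^ eD)      ∎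
  where
  eA = n ∸ a
  eB = suc n ∸ b
  eC = c ∸ 1
  eD = d ∸ 1

boxSum-wt : ∀ n q → boxSum (wt n q) n ≡ abPart n q * cdPart n q
boxSum-wt n q = begin
  boxSum (wt n q) n
    ≡⟨ ∑<-cong (suc n) (λ a b → ∑≤-cong n (wt-split n q a b)) ⟩
  ∑[ a < b ≤ suc n ] ∑[ d ≤ c ≤ n ] (q ^ (n ∸ a) * q ^ (suc n ∸ b)) * (q ^ (c ∸ 1) * q ^ (d ∸ 1))
    ≡⟨ ∑<-cong (suc n) (λ a b → ∑≤-*ˡ n (q ^ (n ∸ a) * q ^ (suc n ∸ b)) _) ⟩
  ∑[ a < b ≤ suc n ] (q ^ (n ∸ a) * q ^ (suc n ∸ b)) * cdPart n q
    ≡⟨ ∑<-*ʳ (suc n) _ (cdPart n q) ⟩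
  abPart n q * cdPart n q ∎

abPart-suc : ∀ n q → abPart (suc n) q ≡ q ^ n * qint (suc n) q + abPart n q
abPart-suc n q = begin
  abPart (suc n) q
    ≡⟨ ∑<-cons (suc n) (λ a b → q ^ (suc n ∸ a) * q ^ (suc (suc n) ∸ b)) ⟩
  ∑[ b ∈ range (suc n) ] q ^ n * q ^ (suc n ∸ b) + abPart n q
    ≡⟨ cong (_+ abPart n q) (∑-*ˡ (q ^ n) (λ b → q ^ (suc n ∸ b)) (range (suc n))) ⟩
  q ^ n * (∑[ b ∈ range (suc n) ] q ^ (suc n ∸ b)) + abPart n q
    ≡⟨ cong (λ x → q ^ n * x + abPart n q)
            (trans (∑-reflect (suc n) (q ^_)) (qint-range (suc n) q)) ⟩
  q ^ n * qint (suc n) q + abPart n q ∎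

cdPart-suc : ∀ n q → cdPart (suc n) q ≡ cdPart n q + q ^ n * qint (suc n) q
cdPart-suc n q = begin
  cdPart (suc n) q
    ≡⟨ ∑≤-suc n _ ⟩
  cdPart n q + ∑[ d ∈ range (suc n) ] q ^ n * q ^ (d ∸ 1)
    ≡⟨ cong (cdPart n q +_) (∑-*ˡ (q ^ n) (λ d → q ^ (d ∸ 1)) (range (suc n))) ⟩
  cdPart n q + q ^ n * (∑[ d ∈ range (suc n) ] q ^ (d ∸ 1))
    ≡⟨ cong (λ x → cdPart n q + q ^ n * x) (qint-range (suc n) q) ⟩
  cdPart n q + q ^ n * qint (suc n) q ∎

abPart≡qtriangular : ∀ n q → abPart n q ≡ qtriangular n q
abPart≡qtriangular n q = sym (∑-telescope {F = λ m → abPart m q} refl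
  (λ m → trans (abPart-suc m q) (+-comm (q ^ m * qint (suc m) q) (abPart m q))) n)

cdPart≡qtriangular : ∀ n q → cdPart n q ≡ qtriangular n q
cdPart≡qtriangular n q = sym (∑-telescope {F = λ m → cdPart m q} refl (λ m → cdPart-suc m q) n)

wsum-box≡qtriangular² : ∀ n q → wsum n q (box n) ≡ qtriangular n q ^ 2
wsum-box≡qtriangular² n q = begin
  wsum n q (box n)                         ≡⟨ ∑-box (wt n q) n ⟩
  boxSum (wt n q) n                        ≡⟨ boxSum-wt n q ⟩
  abPart n q * cdPart n q                  ≡⟨ cong₂ _*_ (abPart≡qtriangular n q)
                                                         (cdPart≡qtriangular n q) ⟩
  qtriangular n q * qtriangular n q        ≡⟨ cong (qtriangular n q *_) (*-identityʳ _) ⟨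
  qtriangular n q ^ 2                      ∎

lemma24 : (n : ℕ) → 2 ≤ n → (q : ℕ) →
    (wsum n q (blockB-ge n) + wsum n q (blockA-lt n) ≡ wsum n q (box n))
    × (wsum n q (box n) ≡ qbinom (suc n) 2 q ^ 2)
-- The hypothesis is used only as n ≥ 1: at n = 0 the second identity fails, as qbinom 1 2 0 = 1.
lemma24 (suc n) _ q =
    blocks-partition-box (wt (suc n) q) (suc n)
  , trans (wsum-box≡qtriangular² (suc n) q) (cong (_^ 2) (sym (qbinom-2≡qtriangular n q)))
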